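{- Under the identification of the vertices of $B^2(\Pi)\cong S_5$ with the permutations of $\{1,2,3,4,5\}$, the canonical map $\varphi$ sends the 120 vertices of the 600-cell $\Pi$ onto exactly the 60 even permutations, with $v$ and $-v$ sent to the same permutation.
   Context: The 600-cell $\Pi$ is the boundary complex of the convex hull in $\mathbb{R}^4=\mathbb{H}$ of the 120 unit quaternions of the binary icosahedral group. A five-coloring of a simplicial complex $X$ is a map $f$ from its vertices to $\{1,\dots,5\}$ with adjacent vertices colored differently (colorings differing by renaming colors identified). $B(X)$ is the simplicial complex whose vertices are the distinct sets $f^{ -1}(c)$ and whose 4-simplices are the sets $\{f^{ -1}(1),\dots,f^{ -1}(5)\}$; $B^2(X)=B(B(X))$; $\varphi:X\to B^2(X)$ sends a vertex $p$ to the set of all vertices $f^{ -1}(c)$ of $B(X)$ containing $p$. $B(\Pi)$ is isomorphic to the complex on the $5\times5$ grid whose 4-simplices are rows and columns, so $B^2(\Pi)$ is isomorphic to the complex $S_5$ whose vertices are subsets of the grid meeting each row and column once (permutations of $\{1,\dots,5\}$) and whose 4-simplices are partitions of the grid into five such sets (Latin squares). -}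

module Defs where

open import Data.Nat using (ℕ; zero; suc; _<_)
open import Data.Nat.Divisibility using (_∣_)
open import Data.Integer as ℤ using (ℤ; +_; -[1+_])
open import Data.Fin using (Fin; #_)
open import Data.Fin.Subset using (Subset; _∈_; inside; outside)
open import Data.Fin.Permutation using (Permutation′; _⟨$⟩ʳ_)
open import Data.Fin.Properties using () renaming (_≟_ to _≟F_)
open import Data.List as List using (List; []; _∷_; _++_; concatMap; length; allFin; filter)
import Data.List.Base
open import Data.Vec as Vec using (Vec; []; _∷_; tabulate; lookup)
open import Data.Product using (Σ; ∃; ∃-syntax; _×_; _,_; proj₁; proj₂)
open import Data.Bool using (Bool; true; false; if_then_else_)
open import Relation.Nullary using (¬_; does)
open import Relation.Nullary.Decidable using (⌊_⌋)
open import Relation.Binary.PropositionalEquality using (_≡_; _≢_)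
open import Data.Fin.Properties using (_<?_)
open import Function.Bundles using (_⇔_)
open import Data.Sum using (_⊎_)

-- The ring ℤ[φ], φ = (1+√5)/2, φ² = φ + 1.  (a , b) represents a + bφ.

Zφ : Set
Zφ = ℤ × ℤ

_+φ_ : Zφ → Zφ → Zφ
(a , b) +φ (c , d) = (a ℤ.+ c , b ℤ.+ d)

_*φ_ : Zφ → Zφ → Zφ
(a , b) *φ (c , d) = (a ℤ.* c ℤ.+ b ℤ.* d , a ℤ.* d ℤ.+ b ℤ.* c ℤ.+ b ℤ.* d)

-φ_ : Zφ → Zφ
-φ (a , b) = (ℤ.- a , ℤ.- b)

-- Points of ℍ = ℝ⁴, stored as TWICE their coordinates (so that all
-- vertices of the 600-cell have coordinates in ℤ[φ]).

Q : Set
Q = Vec Zφ 4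

negQ : Q → Q
negQ = Vec.map -φ_

-- 4 · (Euclidean inner product) of the points represented by u, v.
dot4 : Q → Q → Zφ
dot4 u v = Vec.foldr _ _+φ_ (+ 0 , + 0) (Vec.zipWith _*φ_ u v)

-- scaled coordinate values: 0, ±1, ±φ⁻¹ = φ - 1, ±φ, ±2
c0 c1 cφ⁻¹ cφ c2 : Zφ
c0   = (+ 0 , + 0)
c1   = (+ 1 , + 0)
cφ⁻¹ = (-[1+ 0 ] , + 1)
cφ   = (+ 0 , + 1)
c2   = (+ 2 , + 0)

signs : Zφ → List Zφ
signs x = x ∷ (-φ x) ∷ []

units8 : List Q
units8 = concatMap (λ i → List.map (λ s → tabulate (λ k → if does (k ≟F i) then s else c0)) (signs c2))
                   (allFin 4)

halves16 : List Q
halves16 = concatMap (λ a → concatMap (λ b → concatMap (λ c → List.map (λ d → a ∷ b ∷ c ∷ d ∷ [])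
             (signs c1)) (signs c1)) (signs c1)) (signs c1)

evenPerms4 : List (Vec (Fin 4) 4)
evenPerms4 =
  (# 0 ∷ # 1 ∷ # 2 ∷ # 3 ∷ []) ∷ (# 0 ∷ # 2 ∷ # 3 ∷ # 1 ∷ []) ∷ (# 0 ∷ # 3 ∷ # 1 ∷ # 2 ∷ []) ∷ (# 1 ∷ # 0 ∷ # 3 ∷ # 2 ∷ []) ∷
  (# 1 ∷ # 2 ∷ # 0 ∷ # 3 ∷ []) ∷ (# 1 ∷ # 3 ∷ # 2 ∷ # 0 ∷ []) ∷ (# 2 ∷ # 0 ∷ # 1 ∷ # 3 ∷ []) ∷ (# 2 ∷ # 1 ∷ # 3 ∷ # 0 ∷ []) ∷
  (# 2 ∷ # 3 ∷ # 0 ∷ # 1 ∷ []) ∷ (# 3 ∷ # 0 ∷ # 2 ∷ # 1 ∷ []) ∷ (# 3 ∷ # 1 ∷ # 0 ∷ # 2 ∷ []) ∷ (# 3 ∷ # 2 ∷ # 1 ∷ # 0 ∷ []) ∷ []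

golden96 : List Q
golden96 = concatMap (λ p → concatMap (λ a → concatMap (λ b → List.map (λ c →
             tabulate (λ k → lookup (c0 ∷ a ∷ b ∷ c ∷ []) (lookup p k)))
             (signs cφ)) (signs cφ⁻¹)) (signs c1)) evenPerms4

-- The 120 elements of the binary icosahedral group (twice their coordinates):
-- the vertices of the 600-cell Π.
vertexList : List Q
vertexList = units8 ++ halves16 ++ golden96

V : Set
V = Fin (length vertexList)

vert : V → Q
vert = List.lookup vertexList

-- Two vertices of Π are adjacent (span an edge of the boundary complex of the
-- convex hull) iff they are at the edge distance 1/φ, i.e. ⟨u,v⟩ = φ/2,
-- i.e. 4⟨u,v⟩ = 2φ.
Adjacent : V → V → Set
Adjacent p q = dot4 (vert p) (vert q) ≡ (+ 0 , + 2)

IsFiveColoring : (V → Fin 5) → Set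
IsFiveColoring f = ∀ p q → Adjacent p q → f p ≢ f q

colorClass : (V → Fin 5) → Fin 5 → Subset (length vertexList)
colorClass f c = tabulate (λ p → if does (f p ≟F c) then inside else outside)

IsVertexB : Subset (length vertexList) → Set
IsVertexB S = ∃[ f ] IsFiveColoring f × ∃[ c ] S ≡ colorClass f c

Grid : Set
Grid = Fin 5 × Fin 5

ClassesAreRow : (Grid → Subset (length vertexList)) → (V → Fin 5) → Fin 5 → Set
ClassesAreRow ι f i = (∀ c → ∃[ j ] colorClass f c ≡ ι (i , j))
                    × (∀ j → ∃[ c ] ι (i , j) ≡ colorClass f c)

ClassesAreCol : (Grid → Subset (length vertexList)) → (V → Fin 5) → Fin 5 → Set
ClassesAreCol ι f j = (∀ c → ∃[ i ] colorClass f c ≡ ι (i , j))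
                    × (∀ i → ∃[ c ] ι (i , j) ≡ colorClass f c)

-- ι : Grid → Vert(B(Π)) is an isomorphism of simplicial complexes between the
-- grid complex (4-simplices = rows and columns) and B(Π)
-- (4-simplices = {f⁻¹(1),…,f⁻¹(5)} for five-colorings f).
record GridIso (ι : Grid → Subset (length vertexList)) : Set where
  field
    lands      : ∀ x → IsVertexB (ι x)
    onto       : ∀ S → IsVertexB S → ∃[ x ] ι x ≡ S
    injective  : ∀ x y → ι x ≡ ι y → x ≡ y
    simplices  : ∀ f → IsFiveColoring f →
                 (∃[ i ] ClassesAreRow ι f i) ⊎ (∃[ j ] ClassesAreCol ι f j)
    rowsHit    : ∀ i → ∃[ f ] IsFiveColoring f × ClassesAreRow ι f i
    colsHit    : ∀ j → ∃[ f ] IsFiveColoring f × ClassesAreCol ι f j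

inversions : Permutation′ 5 → ℕ
inversions σ = length (filter (λ ij → (proj₁ ij <? proj₂ ij))
                      (filter (λ ij → (σ ⟨$⟩ʳ proj₂ ij) <? (σ ⟨$⟩ʳ proj₁ ij))
                        (List.cartesianProduct (allFin 5) (allFin 5))))

IsEvenPerm : Permutation′ 5 → Set
IsEvenPerm σ = 2 ∣ inversions σ

-- φ(p), transported to the grid via ι, is the permutation σ
-- (as a subset of the grid: its graph {(i , σ i)}).
PhiIs : (Grid → Subset (length vertexList)) → V → Permutation′ 5 → Set
PhiIs ι p σ = ∀ i j → (p ∈ ι (i , j)) ⇔ (σ ⟨$⟩ʳ i ≡ j)

{-# OPTIONS --safe #-}

-- Each vertex p of Π carries a permutation τ p of the five colours: up to fixed
-- relabellings, the permutation by which p acts by conjugation on the five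
-- binary tetrahedral subgroups of the binary icosahedral group.  Adjacent
-- vertices get permutations that differ at every point, so the row colourings
-- p ↦ τ p i and the column colourings p ↦ (τ p)⁻¹ j are five-colourings, whose
-- colour classes {p | τ p i = j} are the cells of the 5 × 5 grid.  Conversely,
-- a five-colouring is determined up to renaming by its colours on one
-- tetrahedron of Π, and an exhaustive search finds exactly ten extensions of a
-- fixed colouring of that tetrahedron, each a renamed row or column colouring.
-- Hence φ p = τ p, and what remains (τ p is even, every even permutation
-- occurs, τ (−p) = τ p) is a finite check.
module Submission where

open import Defs
open import Data.Product using (∃; ∃-syntax; _×_; _,_)
open import Data.Fin.Subset using (Subset; _∈_)
open import Data.Fin.Permutation using (Permutation′)
open import Data.List using (length)
open import Relation.Binary.PropositionalEquality using (_≡_)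
open import Function.Bundles using (_⇔_)

open import Data.Bool using (true; if_then_else_)
open import Data.Empty using (⊥; ⊥-elim)
open import Data.Fin as Fin using (Fin; zero; suc; punchOut; #_)
open import Data.Fin.Permutation
  using (permutation; _⟨$⟩ʳ_; _⟨$⟩ˡ_; inverseˡ; inverseʳ; transpose; lift₀; flip; _∘ₚ_)
  renaming (id to idₚ)
open import Data.Fin.Properties
  using (_≟_; _<?_; all?; any?; punchOut-injective; punchIn-punchOut; suc-injective; 0≢1+n)
open import Data.Fin.Subset using (Side; inside; outside)
open import Data.Integer using (+_)
open import Data.Integer.Properties using () renaming (_≟_ to _≟ℤ_)
open import Data.List as List using (List; []; _∷_; concatMap; map; allFin; filter; cartesianProduct)
open import Data.List.Membership.Propositional using (lose) renaming (_∈_ to _∈ᴸ_; _∉_ to _∉ᴸ_)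
import Data.List.Membership.DecPropositional as DecMembership
open import Data.List.Membership.Propositional.Properties using (∈-allFin; ∈-concatMap⁺; ∈-map⁻)
open import Data.List.Properties using (filter-≐)
open import Data.List.Relation.Unary.All as All using (All)
open import Data.List.Relation.Unary.Any as Any using (here; there)
open import Data.List.Relation.Unary.Any.Properties using (lookup-index)
open import Data.Maybe using (Maybe; just; nothing)
open import Data.Maybe.Properties using (just-injective) renaming (≡-dec to ≡-decMaybe)
open import Data.Nat using (ℕ; zero; suc)
open import Data.Nat.Divisibility using (_∣_; _∣?_)
open import Data.Product using (proj₁; proj₂; uncurry; map₂)
open import Data.Product.Properties using () renaming (≡-dec to ≡-dec×)
open import Data.Sum as Sum using (_⊎_; inj₁; inj₂)
open import Data.Vec as Vec using (Vec; []; _∷_; lookup; tabulate; _[_]≔_)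
open import Data.Vec.Properties
  using ( lookup∘tabulate; tabulate-cong; tabulate∘lookup; lookup∘update; lookup∘update′
        ; []=⇒lookup; lookup⇒[]=)
  renaming (≡-dec to ≡-decVec)
open import Function using (_∘_)
open import Function.Bundles using (Inverse; Equivalence; mk⇔)
open import Function.Definitions using (Injective)
open import Relation.Binary.PropositionalEquality
  using (refl; sym; trans; cong; cong₂; subst; subst₂; _≢_; module ≡-Reasoning)
open import Relation.Nullary using (Dec; yes; no; does)
open import Relation.Nullary.Decidable
  using (decidable-stable; dec-true; dec-false; does-⇔; map′; _×-dec_; _→-dec_; _⊎-dec_; ¬?)

open DecMembership (_≟_ {120}) using (_∈?_)

-- Permutations of Fin n

⟨$⟩ˡ≡⇔⟨$⟩ʳ≡ : ∀ {n} (π : Permutation′ n) {x y} → π ⟨$⟩ˡ y ≡ x ⇔ π ⟨$⟩ʳ x ≡ y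
⟨$⟩ˡ≡⇔⟨$⟩ʳ≡ π = mk⇔ (λ e → Inverse.inverseˡ π (sym e)) (λ e → Inverse.inverseʳ π (sym e))

permutation-injective : ∀ {n} (π : Permutation′ n) → Injective _≡_ _≡_ (π ⟨$⟩ʳ_)
permutation-injective π {x} {y} eq = begin
  x                  ≡⟨ inverseˡ π ⟨
  π ⟨$⟩ˡ (π ⟨$⟩ʳ x)   ≡⟨ cong (π ⟨$⟩ˡ_) eq ⟩
  π ⟨$⟩ˡ (π ⟨$⟩ʳ y)   ≡⟨ inverseˡ π ⟩
  y                  ∎
  where open ≡-Reasoning

transpose-sends : ∀ {n} (i j : Fin n) → transpose i j ⟨$⟩ʳ j ≡ i
transpose-sends i j with j ≟ i
... | yes j≡i = j≡i
... | no _ rewrite dec-true (j ≟ j) refl = refl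

module _ {m n} {f : Fin (suc m) → Fin (suc n)} (f-inj : Injective _≡_ _≡_ f) where

  private
    α : Permutation′ (suc n)
    α = transpose zero (f zero)

    α∘f∘suc≢zero : ∀ k → zero ≢ α ⟨$⟩ʳ f (suc k)
    α∘f∘suc≢zero k eq =
      0≢1+n (f-inj (permutation-injective α (trans (transpose-sends zero (f zero)) eq)))

  behead : Fin m → Fin n
  behead k = punchOut (α∘f∘suc≢zero k)

  suc∘behead : ∀ k → suc (behead k) ≡ transpose zero (f zero) ⟨$⟩ʳ f (suc k)
  suc∘behead k = punchIn-punchOut (α∘f∘suc≢zero k)

  behead-injective : Injective _≡_ _≡_ behead
  behead-injective eq = suc-injective (f-inj (permutation-injective α
    (punchOut-injective (α∘f∘suc≢zero _) (α∘f∘suc≢zero _) eq)))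

injective⇒∃permutation : ∀ {m n} {f g : Fin m → Fin n} →
  Injective _≡_ _≡_ f → Injective _≡_ _≡_ g → ∃[ π ] ∀ k → π ⟨$⟩ʳ f k ≡ g k
injective⇒∃permutation {zero} _ _ = idₚ , λ ()
injective⇒∃permutation {suc m} {zero} {f} _ _ with f zero
... | ()
injective⇒∃permutation {suc m} {suc n} {f} {g} f-inj g-inj = α ∘ₚ lift₀ ρ ∘ₚ flip β , sends
  where
  open ≡-Reasoning
  α β : Permutation′ (suc n)
  α = transpose zero (f zero)
  β = transpose zero (g zero)
  ρ-spec : ∃[ ρ ] ∀ k → ρ ⟨$⟩ʳ behead f-inj k ≡ behead g-inj k
  ρ-spec = injective⇒∃permutation (behead-injective f-inj) (behead-injective g-inj)
  ρ : Permutation′ n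
  ρ = proj₁ ρ-spec
  β⁻¹-sends : ∀ {x y} → β ⟨$⟩ʳ y ≡ x → β ⟨$⟩ˡ x ≡ y
  β⁻¹-sends e = Inverse.inverseʳ β (sym e)
  after-α : Fin (suc n) → Fin (suc n)
  after-α x = β ⟨$⟩ˡ (lift₀ ρ ⟨$⟩ʳ x)
  sends : ∀ k → (α ∘ₚ lift₀ ρ ∘ₚ flip β) ⟨$⟩ʳ f k ≡ g k
  sends zero = begin
    after-α (α ⟨$⟩ʳ f zero)        ≡⟨ cong after-α (transpose-sends zero (f zero)) ⟩
    β ⟨$⟩ˡ zero                    ≡⟨ β⁻¹-sends (transpose-sends zero (g zero)) ⟩
    g zero                         ∎
  sends (suc k) = begin
    after-α (α ⟨$⟩ʳ f (suc k))     ≡⟨ cong after-α (suc∘behead f-inj k) ⟨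
    β ⟨$⟩ˡ suc (ρ ⟨$⟩ʳ behead f-inj k) ≡⟨ cong (λ x → β ⟨$⟩ˡ suc x) (proj₂ ρ-spec k) ⟩
    β ⟨$⟩ˡ suc (behead g-inj k)    ≡⟨ β⁻¹-sends (sym (suc∘behead g-inj k)) ⟩
    g (suc k)                      ∎

injective⇒permutation : ∀ {n} {h : Fin n → Fin n} →
  Injective _≡_ _≡_ h → ∃[ π ] ∀ k → π ⟨$⟩ʳ k ≡ h k
injective⇒permutation = injective⇒∃permutation (λ eq → eq)

-- The first i with f i ≡ y; the last index if there is none.
preimage : ∀ {n k} → (Fin (suc n) → Fin k) → Fin k → Fin (suc n)
preimage {zero}  f y = zero
preimage {suc n} f y = if does (f zero ≟ y) then zero else suc (preimage (f ∘ suc) y)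

-- Proof by evaluation of a decision procedure. Stated with does a? ≡ true, the
-- evaluation is checked as refl, which Agda does far faster than the True a?
-- of toWitness.
by-evaluation : ∀ {A : Set} (a? : Dec A) → does a? ≡ true → A
by-evaluation (yes a) _ = a

injective? : ∀ {m n} (f : Fin m → Fin n) → Dec (Injective _≡_ _≡_ f)
injective? f = map′ (λ inj {i} {j} → inj i j) (λ inj i j → inj)
  (all? λ i → all? λ j → (f i ≟ f j) →-dec (i ≟ j))

all-vectors? : ∀ {k n} {P : Vec (Fin k) n → Set} → (∀ v → Dec (P v)) → Dec (∀ v → P v)
all-vectors? {n = zero} {P} P? = map′ from-nil (λ h → h []) (P? [])
  where
  from-nil : P [] → ∀ v → P v
  from-nil p [] = p
all-vectors? {n = suc n} {P} P? =
  map′ from-cons (λ h x xs → h (x ∷ xs)) (all? λ x → all-vectors? λ xs → P? (x ∷ xs))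
  where
  from-cons : (∀ x xs → P (x ∷ xs)) → ∀ v → P v
  from-cons h (x ∷ xs) = h x xs

lookup-fromList : ∀ {A : Set} (xs : List A) i → lookup (Vec.fromList xs) i ≡ List.lookup xs i
lookup-fromList (x ∷ xs) zero    = refl
lookup-fromList (x ∷ xs) (suc i) = lookup-fromList xs i

-- Exhaustive search for colourings

module ColouringSearch {n k : ℕ} (neighbours : Fin n → List (Fin n)) where

  PartialColouring : Set
  PartialColouring = Vec (Maybe (Fin k)) n

  open DecMembership (≡-decMaybe (_≟_ {k})) using () renaming (_∈?_ to _∈ᴹ?_)

  coloursAround : PartialColouring → Fin n → List (Maybe (Fin k))
  coloursAround s v = map (lookup s) (neighbours v)

  mutual
    extensions : List (Fin n) → PartialColouring → List PartialColouring
    extensions []       s = s ∷ []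
    extensions (v ∷ vs) s = concatMap (extendWith v vs s (coloursAround s v)) (allFin k)

    extendWith : Fin n → List (Fin n) → PartialColouring → List (Maybe (Fin k)) → Fin k →
                 List PartialColouring
    extendWith v vs s around c =
      if does (just c ∈ᴹ? around) then [] else extensions vs (s [ v ]≔ just c)

  _⊑_ : PartialColouring → (Fin n → Fin k) → Set
  s ⊑ g = ∀ {u c} → lookup s u ≡ just c → g u ≡ c

  module _ {g : Fin n → Fin k} (g-proper : ∀ {v u} → u ∈ᴸ neighbours v → g v ≢ g u) where

    private
      ⊑-extend : ∀ {s} v → s ⊑ g → (s [ v ]≔ just (g v)) ⊑ g
      ⊑-extend {s} v s⊑g {u} eq with u ≟ v
      ... | yes refl = just-injective (trans (sym (lookup∘update u s _)) eq)
      ... | no u≢v   = s⊑g (trans (sym (lookup∘update′ u≢v s _)) eq)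

      no-clash : ∀ {s} v → s ⊑ g → just (g v) ∉ᴸ coloursAround s v
      no-clash v s⊑g clash with ∈-map⁻ _ clash
      ... | _ , u∈ , eq = g-proper u∈ (sym (s⊑g (sym eq)))

    ∈-extensions : ∀ vs s → s ⊑ g → (∀ u → u ∈ᴸ vs ⊎ lookup s u ≡ just (g u)) →
                   tabulate (just ∘ g) ∈ᴸ extensions vs s
    ∈-extensions [] s _ covered = here (begin
      tabulate (just ∘ g)  ≡⟨ tabulate-cong coloured ⟨
      tabulate (lookup s)  ≡⟨ tabulate∘lookup s ⟩
      s                    ∎)
      where
      open ≡-Reasoning
      coloured : ∀ u → lookup s u ≡ just (g u)
      coloured u with covered u
      ... | inj₂ eq = eq
    ∈-extensions (v ∷ vs) s s⊑g covered =
      ∈-concatMap⁺ (extendWith v vs s (coloursAround s v)) (lose (∈-allFin (g v)) chosen)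
      where
      covered′ : ∀ u → u ∈ᴸ vs ⊎ lookup (s [ v ]≔ just (g v)) u ≡ just (g u)
      covered′ u with u ≟ v
      ... | yes refl = inj₂ (lookup∘update u s _)
      ... | no u≢v with covered u
      ...   | inj₁ (here u≡v)   = ⊥-elim (u≢v u≡v)
      ...   | inj₁ (there u∈vs) = inj₁ u∈vs
      ...   | inj₂ eq           = inj₂ (trans (lookup∘update′ u≢v s _) eq)
      chosen : tabulate (just ∘ g) ∈ᴸ extendWith v vs s (coloursAround s v) (g v)
      chosen = subst (λ b → tabulate (just ∘ g) ∈ᴸ (if b then [] else extensions vs _))
        (sym (dec-false (just (g v) ∈ᴹ? coloursAround s v) (no-clash {s} v s⊑g)))
        (∈-extensions vs _ (⊑-extend {s} v s⊑g) covered′)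

∈-colorClass : ∀ {f c p} → p ∈ colorClass f c ⇔ f p ≡ c
∈-colorClass {f} {c} {p} = mk⇔
  (λ m → inside⇒ (f p ≟ c) (trans (sym (lookup∘tabulate F p)) ([]=⇒lookup m)))
  (λ e → lookup⇒[]= p (colorClass f c)
           (trans (lookup∘tabulate F p) (cong (λ b → if b then inside else outside) (dec-true (f p ≟ c) e))))
  where
  F : V → Side
  F q = if does (f q ≟ c) then inside else outside
  inside⇒ : ∀ {A : Set} (a? : Dec A) → (if does a? then inside else outside) ≡ inside → A
  inside⇒ (yes a) _ = a

colorClass-cong : ∀ {f g c d} → (∀ p → f p ≡ c ⇔ g p ≡ d) → colorClass f c ≡ colorClass g d
colorClass-cong {f} {g} {c} {d} iff =
  tabulate-cong {f = λ p → if does (f p ≟ c) then inside else outside}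
                {g = λ p → if does (g p ≟ d) then inside else outside} λ p →
  cong (λ b → if b then inside else outside) (does-⇔ (iff p) (f p ≟ c) (g p ≟ d))

Renaming : (V → Fin 5) → (V → Fin 5) → Set
Renaming f g = ∃[ σ ] ∀ p → f p ≡ σ ⟨$⟩ʳ g p

renaming-∘ : ∀ {f g} π → Renaming (λ p → π ⟨$⟩ʳ f p) g → Renaming f g
renaming-∘ π (σ , π∘f≡σ∘g) =
  σ ∘ₚ flip π , λ p → sym (Equivalence.from (⟨$⟩ˡ≡⇔⟨$⟩ʳ≡ π) (π∘f≡σ∘g p))

colorClass-renaming : ∀ {f g} (r : Renaming f g) c → colorClass f c ≡ colorClass g (proj₁ r ⟨$⟩ˡ c)
colorClass-renaming {f} {g} (σ , f≡σ∘g) c = colorClass-cong {f} {g} {c} {σ ⟨$⟩ˡ c} λ p →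
  mk⇔ (λ e → sym (Equivalence.from (⟨$⟩ˡ≡⇔⟨$⟩ʳ≡ σ) (trans (sym (f≡σ∘g p)) e)))
      (λ e → trans (f≡σ∘g p) (Equivalence.to (⟨$⟩ˡ≡⇔⟨$⟩ʳ≡ σ) (sym e)))

-- The labelling of the vertices by permutations

-- Decision procedures over the vertices quantify over Fin 120 rather than the
-- equal V = Fin (length vertexList): recursion on a literal size does not
-- recompute the vertex list at every step.
all-vertices? : ∀ {P : V → Set} → (∀ p → Dec (P p)) → Dec (∀ p → P p)
all-vertices? = all? {n = 120}

any-vertex? : ∀ {P : V → Set} → (∀ p → Dec (P p)) → Dec (∃ P)
any-vertex? = any? {n = 120}

-- Reads the tables below, which are written with natural numbers; every entry
-- is within range, so the saturation at the last element never applies.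
toFin : ∀ {n} → ℕ → Fin (suc n)
toFin zero              = zero
toFin {zero}  (suc _)   = zero
toFin {suc n} (suc k)   = suc (toFin k)

τ-table : Vec (Vec ℕ 5) 120
τ-table =
  (1 ∷ 0 ∷ 3 ∷ 2 ∷ 4 ∷ []) ∷ (1 ∷ 0 ∷ 3 ∷ 2 ∷ 4 ∷ []) ∷ (2 ∷ 4 ∷ 3 ∷ 1 ∷ 0 ∷ []) ∷ (2 ∷ 4 ∷ 3 ∷ 1 ∷ 0 ∷ []) ∷
  (0 ∷ 1 ∷ 3 ∷ 4 ∷ 2 ∷ []) ∷ (0 ∷ 1 ∷ 3 ∷ 4 ∷ 2 ∷ []) ∷ (4 ∷ 2 ∷ 3 ∷ 0 ∷ 1 ∷ []) ∷ (4 ∷ 2 ∷ 3 ∷ 0 ∷ 1 ∷ []) ∷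
  (4 ∷ 1 ∷ 3 ∷ 2 ∷ 0 ∷ []) ∷ (4 ∷ 0 ∷ 3 ∷ 1 ∷ 2 ∷ []) ∷ (2 ∷ 1 ∷ 3 ∷ 0 ∷ 4 ∷ []) ∷ (1 ∷ 4 ∷ 3 ∷ 0 ∷ 2 ∷ []) ∷
  (1 ∷ 2 ∷ 3 ∷ 4 ∷ 0 ∷ []) ∷ (0 ∷ 2 ∷ 3 ∷ 1 ∷ 4 ∷ []) ∷ (2 ∷ 0 ∷ 3 ∷ 4 ∷ 1 ∷ []) ∷ (0 ∷ 4 ∷ 3 ∷ 2 ∷ 1 ∷ []) ∷
  (0 ∷ 4 ∷ 3 ∷ 2 ∷ 1 ∷ []) ∷ (2 ∷ 0 ∷ 3 ∷ 4 ∷ 1 ∷ []) ∷ (0 ∷ 2 ∷ 3 ∷ 1 ∷ 4 ∷ []) ∷ (1 ∷ 2 ∷ 3 ∷ 4 ∷ 0 ∷ []) ∷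
  (1 ∷ 4 ∷ 3 ∷ 0 ∷ 2 ∷ []) ∷ (2 ∷ 1 ∷ 3 ∷ 0 ∷ 4 ∷ []) ∷ (4 ∷ 0 ∷ 3 ∷ 1 ∷ 2 ∷ []) ∷ (4 ∷ 1 ∷ 3 ∷ 2 ∷ 0 ∷ []) ∷
  (2 ∷ 3 ∷ 0 ∷ 1 ∷ 4 ∷ []) ∷ (1 ∷ 4 ∷ 2 ∷ 3 ∷ 0 ∷ []) ∷ (3 ∷ 4 ∷ 1 ∷ 2 ∷ 0 ∷ []) ∷ (2 ∷ 0 ∷ 4 ∷ 1 ∷ 3 ∷ []) ∷
  (2 ∷ 0 ∷ 4 ∷ 1 ∷ 3 ∷ []) ∷ (3 ∷ 4 ∷ 1 ∷ 2 ∷ 0 ∷ []) ∷ (1 ∷ 4 ∷ 2 ∷ 3 ∷ 0 ∷ []) ∷ (2 ∷ 3 ∷ 0 ∷ 1 ∷ 4 ∷ []) ∷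
  (1 ∷ 2 ∷ 4 ∷ 0 ∷ 3 ∷ []) ∷ (4 ∷ 0 ∷ 2 ∷ 3 ∷ 1 ∷ []) ∷ (4 ∷ 3 ∷ 0 ∷ 2 ∷ 1 ∷ []) ∷ (3 ∷ 2 ∷ 1 ∷ 0 ∷ 4 ∷ []) ∷
  (3 ∷ 2 ∷ 1 ∷ 0 ∷ 4 ∷ []) ∷ (4 ∷ 3 ∷ 0 ∷ 2 ∷ 1 ∷ []) ∷ (4 ∷ 0 ∷ 2 ∷ 3 ∷ 1 ∷ []) ∷ (1 ∷ 2 ∷ 4 ∷ 0 ∷ 3 ∷ []) ∷
  (3 ∷ 0 ∷ 1 ∷ 4 ∷ 2 ∷ []) ∷ (0 ∷ 1 ∷ 2 ∷ 3 ∷ 4 ∷ []) ∷ (0 ∷ 1 ∷ 4 ∷ 2 ∷ 3 ∷ []) ∷ (1 ∷ 3 ∷ 0 ∷ 4 ∷ 2 ∷ []) ∷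
  (1 ∷ 3 ∷ 0 ∷ 4 ∷ 2 ∷ []) ∷ (0 ∷ 1 ∷ 4 ∷ 2 ∷ 3 ∷ []) ∷ (0 ∷ 1 ∷ 2 ∷ 3 ∷ 4 ∷ []) ∷ (3 ∷ 0 ∷ 1 ∷ 4 ∷ 2 ∷ []) ∷
  (3 ∷ 0 ∷ 2 ∷ 1 ∷ 4 ∷ []) ∷ (1 ∷ 4 ∷ 0 ∷ 2 ∷ 3 ∷ []) ∷ (1 ∷ 3 ∷ 4 ∷ 2 ∷ 0 ∷ []) ∷ (2 ∷ 0 ∷ 1 ∷ 3 ∷ 4 ∷ []) ∷
  (2 ∷ 0 ∷ 1 ∷ 3 ∷ 4 ∷ []) ∷ (1 ∷ 3 ∷ 4 ∷ 2 ∷ 0 ∷ []) ∷ (1 ∷ 4 ∷ 0 ∷ 2 ∷ 3 ∷ []) ∷ (3 ∷ 0 ∷ 2 ∷ 1 ∷ 4 ∷ []) ∷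
  (1 ∷ 0 ∷ 2 ∷ 4 ∷ 3 ∷ []) ∷ (0 ∷ 3 ∷ 1 ∷ 2 ∷ 4 ∷ []) ∷ (3 ∷ 1 ∷ 0 ∷ 2 ∷ 4 ∷ []) ∷ (1 ∷ 0 ∷ 4 ∷ 3 ∷ 2 ∷ []) ∷
  (1 ∷ 0 ∷ 4 ∷ 3 ∷ 2 ∷ []) ∷ (3 ∷ 1 ∷ 0 ∷ 2 ∷ 4 ∷ []) ∷ (0 ∷ 3 ∷ 1 ∷ 2 ∷ 4 ∷ []) ∷ (1 ∷ 0 ∷ 2 ∷ 4 ∷ 3 ∷ []) ∷
  (1 ∷ 3 ∷ 2 ∷ 0 ∷ 4 ∷ []) ∷ (3 ∷ 0 ∷ 4 ∷ 2 ∷ 1 ∷ []) ∷ (4 ∷ 0 ∷ 1 ∷ 2 ∷ 3 ∷ []) ∷ (1 ∷ 2 ∷ 0 ∷ 3 ∷ 4 ∷ []) ∷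
  (1 ∷ 2 ∷ 0 ∷ 3 ∷ 4 ∷ []) ∷ (4 ∷ 0 ∷ 1 ∷ 2 ∷ 3 ∷ []) ∷ (3 ∷ 0 ∷ 4 ∷ 2 ∷ 1 ∷ []) ∷ (1 ∷ 3 ∷ 2 ∷ 0 ∷ 4 ∷ []) ∷
  (0 ∷ 4 ∷ 1 ∷ 3 ∷ 2 ∷ []) ∷ (2 ∷ 1 ∷ 0 ∷ 4 ∷ 3 ∷ []) ∷ (3 ∷ 1 ∷ 2 ∷ 4 ∷ 0 ∷ []) ∷ (0 ∷ 3 ∷ 4 ∷ 1 ∷ 2 ∷ []) ∷
  (0 ∷ 3 ∷ 4 ∷ 1 ∷ 2 ∷ []) ∷ (3 ∷ 1 ∷ 2 ∷ 4 ∷ 0 ∷ []) ∷ (2 ∷ 1 ∷ 0 ∷ 4 ∷ 3 ∷ []) ∷ (0 ∷ 4 ∷ 1 ∷ 3 ∷ 2 ∷ []) ∷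
  (2 ∷ 4 ∷ 0 ∷ 3 ∷ 1 ∷ []) ∷ (3 ∷ 2 ∷ 4 ∷ 1 ∷ 0 ∷ []) ∷ (4 ∷ 3 ∷ 2 ∷ 1 ∷ 0 ∷ []) ∷ (2 ∷ 4 ∷ 1 ∷ 0 ∷ 3 ∷ []) ∷
  (2 ∷ 4 ∷ 1 ∷ 0 ∷ 3 ∷ []) ∷ (4 ∷ 3 ∷ 2 ∷ 1 ∷ 0 ∷ []) ∷ (3 ∷ 2 ∷ 4 ∷ 1 ∷ 0 ∷ []) ∷ (2 ∷ 4 ∷ 0 ∷ 3 ∷ 1 ∷ []) ∷
  (0 ∷ 2 ∷ 4 ∷ 3 ∷ 1 ∷ []) ∷ (4 ∷ 3 ∷ 1 ∷ 0 ∷ 2 ∷ []) ∷ (4 ∷ 1 ∷ 2 ∷ 0 ∷ 3 ∷ []) ∷ (3 ∷ 2 ∷ 0 ∷ 4 ∷ 1 ∷ []) ∷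
  (3 ∷ 2 ∷ 0 ∷ 4 ∷ 1 ∷ []) ∷ (4 ∷ 1 ∷ 2 ∷ 0 ∷ 3 ∷ []) ∷ (4 ∷ 3 ∷ 1 ∷ 0 ∷ 2 ∷ []) ∷ (0 ∷ 2 ∷ 4 ∷ 3 ∷ 1 ∷ []) ∷
  (2 ∷ 3 ∷ 4 ∷ 0 ∷ 1 ∷ []) ∷ (4 ∷ 2 ∷ 0 ∷ 1 ∷ 3 ∷ []) ∷ (4 ∷ 2 ∷ 1 ∷ 3 ∷ 0 ∷ []) ∷ (3 ∷ 4 ∷ 2 ∷ 0 ∷ 1 ∷ []) ∷
  (3 ∷ 4 ∷ 2 ∷ 0 ∷ 1 ∷ []) ∷ (4 ∷ 2 ∷ 1 ∷ 3 ∷ 0 ∷ []) ∷ (4 ∷ 2 ∷ 0 ∷ 1 ∷ 3 ∷ []) ∷ (2 ∷ 3 ∷ 4 ∷ 0 ∷ 1 ∷ []) ∷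
  (3 ∷ 4 ∷ 0 ∷ 1 ∷ 2 ∷ []) ∷ (2 ∷ 3 ∷ 1 ∷ 4 ∷ 0 ∷ []) ∷ (2 ∷ 1 ∷ 4 ∷ 3 ∷ 0 ∷ []) ∷ (0 ∷ 4 ∷ 2 ∷ 1 ∷ 3 ∷ []) ∷
  (0 ∷ 4 ∷ 2 ∷ 1 ∷ 3 ∷ []) ∷ (2 ∷ 1 ∷ 4 ∷ 3 ∷ 0 ∷ []) ∷ (2 ∷ 3 ∷ 1 ∷ 4 ∷ 0 ∷ []) ∷ (3 ∷ 4 ∷ 0 ∷ 1 ∷ 2 ∷ []) ∷
  (0 ∷ 2 ∷ 1 ∷ 4 ∷ 3 ∷ []) ∷ (3 ∷ 1 ∷ 4 ∷ 0 ∷ 2 ∷ []) ∷ (4 ∷ 1 ∷ 0 ∷ 3 ∷ 2 ∷ []) ∷ (0 ∷ 3 ∷ 2 ∷ 4 ∷ 1 ∷ []) ∷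
  (0 ∷ 3 ∷ 2 ∷ 4 ∷ 1 ∷ []) ∷ (4 ∷ 1 ∷ 0 ∷ 3 ∷ 2 ∷ []) ∷ (3 ∷ 1 ∷ 4 ∷ 0 ∷ 2 ∷ []) ∷ (0 ∷ 2 ∷ 1 ∷ 4 ∷ 3 ∷ []) ∷ []

τ : Fin 120 → Fin 5 → Fin 5
τ p i = toFin (lookup (lookup τ-table p) i)

τ⁻¹ : Fin 120 → Fin 5 → Fin 5
τ⁻¹ p = preimage (τ p)

φ : V → Permutation′ 5
φ p = permutation (τ p) (τ⁻¹ p)
  (by-evaluation (all-vertices? λ p → all? λ j → τ p (τ⁻¹ p j) ≟ j) refl p)
  (by-evaluation (all-vertices? λ p → all? λ i → τ⁻¹ p (τ p i) ≟ i) refl p)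

neighbourTable : Vec (List ℕ) 120
neighbourTable =
  (96 ∷ 98 ∷ 100 ∷ 102 ∷ 104 ∷ 106 ∷ 108 ∷ 110 ∷ 112 ∷ 114 ∷ 116 ∷ 118 ∷ []) ∷ (97 ∷ 99 ∷ 101 ∷ 103 ∷ 105 ∷ 107 ∷ 109 ∷ 111 ∷ 113 ∷ 115 ∷ 117 ∷ 119 ∷ []) ∷
  (40 ∷ 42 ∷ 44 ∷ 46 ∷ 64 ∷ 66 ∷ 68 ∷ 70 ∷ 88 ∷ 90 ∷ 92 ∷ 94 ∷ []) ∷ (41 ∷ 43 ∷ 45 ∷ 47 ∷ 65 ∷ 67 ∷ 69 ∷ 71 ∷ 89 ∷ 91 ∷ 93 ∷ 95 ∷ []) ∷
  (32 ∷ 34 ∷ 36 ∷ 38 ∷ 48 ∷ 50 ∷ 52 ∷ 54 ∷ 80 ∷ 82 ∷ 84 ∷ 86 ∷ []) ∷ (33 ∷ 35 ∷ 37 ∷ 39 ∷ 49 ∷ 51 ∷ 53 ∷ 55 ∷ 81 ∷ 83 ∷ 85 ∷ 87 ∷ []) ∷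
  (24 ∷ 26 ∷ 28 ∷ 30 ∷ 56 ∷ 58 ∷ 60 ∷ 62 ∷ 72 ∷ 74 ∷ 76 ∷ 78 ∷ []) ∷ (25 ∷ 27 ∷ 29 ∷ 31 ∷ 57 ∷ 59 ∷ 61 ∷ 63 ∷ 73 ∷ 75 ∷ 77 ∷ 79 ∷ []) ∷
  (24 ∷ 32 ∷ 40 ∷ 48 ∷ 56 ∷ 64 ∷ 72 ∷ 80 ∷ 88 ∷ 96 ∷ 104 ∷ 112 ∷ []) ∷ (25 ∷ 36 ∷ 42 ∷ 50 ∷ 57 ∷ 64 ∷ 73 ∷ 80 ∷ 92 ∷ 100 ∷ 106 ∷ 112 ∷ []) ∷
  (26 ∷ 33 ∷ 44 ∷ 49 ∷ 56 ∷ 66 ∷ 76 ∷ 81 ∷ 88 ∷ 98 ∷ 104 ∷ 116 ∷ []) ∷ (27 ∷ 37 ∷ 46 ∷ 51 ∷ 57 ∷ 66 ∷ 77 ∷ 81 ∷ 92 ∷ 102 ∷ 106 ∷ 116 ∷ []) ∷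
  (28 ∷ 34 ∷ 41 ∷ 48 ∷ 58 ∷ 65 ∷ 72 ∷ 84 ∷ 89 ∷ 96 ∷ 108 ∷ 114 ∷ []) ∷ (29 ∷ 38 ∷ 43 ∷ 50 ∷ 59 ∷ 65 ∷ 73 ∷ 84 ∷ 93 ∷ 100 ∷ 110 ∷ 114 ∷ []) ∷
  (30 ∷ 35 ∷ 45 ∷ 49 ∷ 58 ∷ 67 ∷ 76 ∷ 85 ∷ 89 ∷ 98 ∷ 108 ∷ 118 ∷ []) ∷ (31 ∷ 39 ∷ 47 ∷ 51 ∷ 59 ∷ 67 ∷ 77 ∷ 85 ∷ 93 ∷ 102 ∷ 110 ∷ 118 ∷ []) ∷
  (24 ∷ 32 ∷ 40 ∷ 52 ∷ 60 ∷ 68 ∷ 74 ∷ 82 ∷ 90 ∷ 97 ∷ 105 ∷ 113 ∷ []) ∷ (25 ∷ 36 ∷ 42 ∷ 54 ∷ 61 ∷ 68 ∷ 75 ∷ 82 ∷ 94 ∷ 101 ∷ 107 ∷ 113 ∷ []) ∷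
  (26 ∷ 33 ∷ 44 ∷ 53 ∷ 60 ∷ 70 ∷ 78 ∷ 83 ∷ 90 ∷ 99 ∷ 105 ∷ 117 ∷ []) ∷ (27 ∷ 37 ∷ 46 ∷ 55 ∷ 61 ∷ 70 ∷ 79 ∷ 83 ∷ 94 ∷ 103 ∷ 107 ∷ 117 ∷ []) ∷
  (28 ∷ 34 ∷ 41 ∷ 52 ∷ 62 ∷ 69 ∷ 74 ∷ 86 ∷ 91 ∷ 97 ∷ 109 ∷ 115 ∷ []) ∷ (29 ∷ 38 ∷ 43 ∷ 54 ∷ 63 ∷ 69 ∷ 75 ∷ 86 ∷ 95 ∷ 101 ∷ 111 ∷ 115 ∷ []) ∷
  (30 ∷ 35 ∷ 45 ∷ 53 ∷ 62 ∷ 71 ∷ 78 ∷ 87 ∷ 91 ∷ 99 ∷ 109 ∷ 119 ∷ []) ∷ (31 ∷ 39 ∷ 47 ∷ 55 ∷ 63 ∷ 71 ∷ 79 ∷ 87 ∷ 95 ∷ 103 ∷ 111 ∷ 119 ∷ []) ∷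
  (6 ∷ 8 ∷ 16 ∷ 26 ∷ 32 ∷ 40 ∷ 56 ∷ 60 ∷ 72 ∷ 74 ∷ 88 ∷ 90 ∷ []) ∷ (7 ∷ 9 ∷ 17 ∷ 27 ∷ 36 ∷ 42 ∷ 57 ∷ 61 ∷ 73 ∷ 75 ∷ 92 ∷ 94 ∷ []) ∷
  (6 ∷ 10 ∷ 18 ∷ 24 ∷ 33 ∷ 44 ∷ 56 ∷ 60 ∷ 76 ∷ 78 ∷ 88 ∷ 90 ∷ []) ∷ (7 ∷ 11 ∷ 19 ∷ 25 ∷ 37 ∷ 46 ∷ 57 ∷ 61 ∷ 77 ∷ 79 ∷ 92 ∷ 94 ∷ []) ∷
  (6 ∷ 12 ∷ 20 ∷ 30 ∷ 34 ∷ 41 ∷ 58 ∷ 62 ∷ 72 ∷ 74 ∷ 89 ∷ 91 ∷ []) ∷ (7 ∷ 13 ∷ 21 ∷ 31 ∷ 38 ∷ 43 ∷ 59 ∷ 63 ∷ 73 ∷ 75 ∷ 93 ∷ 95 ∷ []) ∷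
  (6 ∷ 14 ∷ 22 ∷ 28 ∷ 35 ∷ 45 ∷ 58 ∷ 62 ∷ 76 ∷ 78 ∷ 89 ∷ 91 ∷ []) ∷ (7 ∷ 15 ∷ 23 ∷ 29 ∷ 39 ∷ 47 ∷ 59 ∷ 63 ∷ 77 ∷ 79 ∷ 93 ∷ 95 ∷ []) ∷
  (4 ∷ 8 ∷ 16 ∷ 24 ∷ 34 ∷ 40 ∷ 48 ∷ 52 ∷ 72 ∷ 74 ∷ 80 ∷ 82 ∷ []) ∷ (5 ∷ 10 ∷ 18 ∷ 26 ∷ 35 ∷ 44 ∷ 49 ∷ 53 ∷ 76 ∷ 78 ∷ 81 ∷ 83 ∷ []) ∷
  (4 ∷ 12 ∷ 20 ∷ 28 ∷ 32 ∷ 41 ∷ 48 ∷ 52 ∷ 72 ∷ 74 ∷ 84 ∷ 86 ∷ []) ∷ (5 ∷ 14 ∷ 22 ∷ 30 ∷ 33 ∷ 45 ∷ 49 ∷ 53 ∷ 76 ∷ 78 ∷ 85 ∷ 87 ∷ []) ∷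
  (4 ∷ 9 ∷ 17 ∷ 25 ∷ 38 ∷ 42 ∷ 50 ∷ 54 ∷ 73 ∷ 75 ∷ 80 ∷ 82 ∷ []) ∷ (5 ∷ 11 ∷ 19 ∷ 27 ∷ 39 ∷ 46 ∷ 51 ∷ 55 ∷ 77 ∷ 79 ∷ 81 ∷ 83 ∷ []) ∷
  (4 ∷ 13 ∷ 21 ∷ 29 ∷ 36 ∷ 43 ∷ 50 ∷ 54 ∷ 73 ∷ 75 ∷ 84 ∷ 86 ∷ []) ∷ (5 ∷ 15 ∷ 23 ∷ 31 ∷ 37 ∷ 47 ∷ 51 ∷ 55 ∷ 77 ∷ 79 ∷ 85 ∷ 87 ∷ []) ∷
  (2 ∷ 8 ∷ 16 ∷ 24 ∷ 32 ∷ 42 ∷ 64 ∷ 68 ∷ 80 ∷ 82 ∷ 88 ∷ 90 ∷ []) ∷ (3 ∷ 12 ∷ 20 ∷ 28 ∷ 34 ∷ 43 ∷ 65 ∷ 69 ∷ 84 ∷ 86 ∷ 89 ∷ 91 ∷ []) ∷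
  (2 ∷ 9 ∷ 17 ∷ 25 ∷ 36 ∷ 40 ∷ 64 ∷ 68 ∷ 80 ∷ 82 ∷ 92 ∷ 94 ∷ []) ∷ (3 ∷ 13 ∷ 21 ∷ 29 ∷ 38 ∷ 41 ∷ 65 ∷ 69 ∷ 84 ∷ 86 ∷ 93 ∷ 95 ∷ []) ∷
  (2 ∷ 10 ∷ 18 ∷ 26 ∷ 33 ∷ 46 ∷ 66 ∷ 70 ∷ 81 ∷ 83 ∷ 88 ∷ 90 ∷ []) ∷ (3 ∷ 14 ∷ 22 ∷ 30 ∷ 35 ∷ 47 ∷ 67 ∷ 71 ∷ 85 ∷ 87 ∷ 89 ∷ 91 ∷ []) ∷
  (2 ∷ 11 ∷ 19 ∷ 27 ∷ 37 ∷ 44 ∷ 66 ∷ 70 ∷ 81 ∷ 83 ∷ 92 ∷ 94 ∷ []) ∷ (3 ∷ 15 ∷ 23 ∷ 31 ∷ 39 ∷ 45 ∷ 67 ∷ 71 ∷ 85 ∷ 87 ∷ 93 ∷ 95 ∷ []) ∷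
  (4 ∷ 8 ∷ 12 ∷ 32 ∷ 34 ∷ 50 ∷ 72 ∷ 80 ∷ 84 ∷ 96 ∷ 112 ∷ 114 ∷ []) ∷ (5 ∷ 10 ∷ 14 ∷ 33 ∷ 35 ∷ 51 ∷ 76 ∷ 81 ∷ 85 ∷ 98 ∷ 116 ∷ 118 ∷ []) ∷
  (4 ∷ 9 ∷ 13 ∷ 36 ∷ 38 ∷ 48 ∷ 73 ∷ 80 ∷ 84 ∷ 100 ∷ 112 ∷ 114 ∷ []) ∷ (5 ∷ 11 ∷ 15 ∷ 37 ∷ 39 ∷ 49 ∷ 77 ∷ 81 ∷ 85 ∷ 102 ∷ 116 ∷ 118 ∷ []) ∷
  (4 ∷ 16 ∷ 20 ∷ 32 ∷ 34 ∷ 54 ∷ 74 ∷ 82 ∷ 86 ∷ 97 ∷ 113 ∷ 115 ∷ []) ∷ (5 ∷ 18 ∷ 22 ∷ 33 ∷ 35 ∷ 55 ∷ 78 ∷ 83 ∷ 87 ∷ 99 ∷ 117 ∷ 119 ∷ []) ∷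
  (4 ∷ 17 ∷ 21 ∷ 36 ∷ 38 ∷ 52 ∷ 75 ∷ 82 ∷ 86 ∷ 101 ∷ 113 ∷ 115 ∷ []) ∷ (5 ∷ 19 ∷ 23 ∷ 37 ∷ 39 ∷ 53 ∷ 79 ∷ 83 ∷ 87 ∷ 103 ∷ 117 ∷ 119 ∷ []) ∷
  (6 ∷ 8 ∷ 10 ∷ 24 ∷ 26 ∷ 58 ∷ 72 ∷ 76 ∷ 88 ∷ 96 ∷ 98 ∷ 104 ∷ []) ∷ (7 ∷ 9 ∷ 11 ∷ 25 ∷ 27 ∷ 59 ∷ 73 ∷ 77 ∷ 92 ∷ 100 ∷ 102 ∷ 106 ∷ []) ∷
  (6 ∷ 12 ∷ 14 ∷ 28 ∷ 30 ∷ 56 ∷ 72 ∷ 76 ∷ 89 ∷ 96 ∷ 98 ∷ 108 ∷ []) ∷ (7 ∷ 13 ∷ 15 ∷ 29 ∷ 31 ∷ 57 ∷ 73 ∷ 77 ∷ 93 ∷ 100 ∷ 102 ∷ 110 ∷ []) ∷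
  (6 ∷ 16 ∷ 18 ∷ 24 ∷ 26 ∷ 62 ∷ 74 ∷ 78 ∷ 90 ∷ 97 ∷ 99 ∷ 105 ∷ []) ∷ (7 ∷ 17 ∷ 19 ∷ 25 ∷ 27 ∷ 63 ∷ 75 ∷ 79 ∷ 94 ∷ 101 ∷ 103 ∷ 107 ∷ []) ∷
  (6 ∷ 20 ∷ 22 ∷ 28 ∷ 30 ∷ 60 ∷ 74 ∷ 78 ∷ 91 ∷ 97 ∷ 99 ∷ 109 ∷ []) ∷ (7 ∷ 21 ∷ 23 ∷ 29 ∷ 31 ∷ 61 ∷ 75 ∷ 79 ∷ 95 ∷ 101 ∷ 103 ∷ 111 ∷ []) ∷
  (2 ∷ 8 ∷ 9 ∷ 40 ∷ 42 ∷ 66 ∷ 80 ∷ 88 ∷ 92 ∷ 104 ∷ 106 ∷ 112 ∷ []) ∷ (3 ∷ 12 ∷ 13 ∷ 41 ∷ 43 ∷ 67 ∷ 84 ∷ 89 ∷ 93 ∷ 108 ∷ 110 ∷ 114 ∷ []) ∷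
  (2 ∷ 10 ∷ 11 ∷ 44 ∷ 46 ∷ 64 ∷ 81 ∷ 88 ∷ 92 ∷ 104 ∷ 106 ∷ 116 ∷ []) ∷ (3 ∷ 14 ∷ 15 ∷ 45 ∷ 47 ∷ 65 ∷ 85 ∷ 89 ∷ 93 ∷ 108 ∷ 110 ∷ 118 ∷ []) ∷
  (2 ∷ 16 ∷ 17 ∷ 40 ∷ 42 ∷ 70 ∷ 82 ∷ 90 ∷ 94 ∷ 105 ∷ 107 ∷ 113 ∷ []) ∷ (3 ∷ 20 ∷ 21 ∷ 41 ∷ 43 ∷ 71 ∷ 86 ∷ 91 ∷ 95 ∷ 109 ∷ 111 ∷ 115 ∷ []) ∷
  (2 ∷ 18 ∷ 19 ∷ 44 ∷ 46 ∷ 68 ∷ 83 ∷ 90 ∷ 94 ∷ 105 ∷ 107 ∷ 117 ∷ []) ∷ (3 ∷ 22 ∷ 23 ∷ 45 ∷ 47 ∷ 69 ∷ 87 ∷ 91 ∷ 95 ∷ 109 ∷ 111 ∷ 119 ∷ []) ∷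
  (6 ∷ 8 ∷ 12 ∷ 24 ∷ 28 ∷ 32 ∷ 34 ∷ 48 ∷ 56 ∷ 58 ∷ 74 ∷ 96 ∷ []) ∷ (7 ∷ 9 ∷ 13 ∷ 25 ∷ 29 ∷ 36 ∷ 38 ∷ 50 ∷ 57 ∷ 59 ∷ 75 ∷ 100 ∷ []) ∷
  (6 ∷ 16 ∷ 20 ∷ 24 ∷ 28 ∷ 32 ∷ 34 ∷ 52 ∷ 60 ∷ 62 ∷ 72 ∷ 97 ∷ []) ∷ (7 ∷ 17 ∷ 21 ∷ 25 ∷ 29 ∷ 36 ∷ 38 ∷ 54 ∷ 61 ∷ 63 ∷ 73 ∷ 101 ∷ []) ∷
  (6 ∷ 10 ∷ 14 ∷ 26 ∷ 30 ∷ 33 ∷ 35 ∷ 49 ∷ 56 ∷ 58 ∷ 78 ∷ 98 ∷ []) ∷ (7 ∷ 11 ∷ 15 ∷ 27 ∷ 31 ∷ 37 ∷ 39 ∷ 51 ∷ 57 ∷ 59 ∷ 79 ∷ 102 ∷ []) ∷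
  (6 ∷ 18 ∷ 22 ∷ 26 ∷ 30 ∷ 33 ∷ 35 ∷ 53 ∷ 60 ∷ 62 ∷ 76 ∷ 99 ∷ []) ∷ (7 ∷ 19 ∷ 23 ∷ 27 ∷ 31 ∷ 37 ∷ 39 ∷ 55 ∷ 61 ∷ 63 ∷ 77 ∷ 103 ∷ []) ∷
  (4 ∷ 8 ∷ 9 ∷ 32 ∷ 36 ∷ 40 ∷ 42 ∷ 48 ∷ 50 ∷ 64 ∷ 82 ∷ 112 ∷ []) ∷ (5 ∷ 10 ∷ 11 ∷ 33 ∷ 37 ∷ 44 ∷ 46 ∷ 49 ∷ 51 ∷ 66 ∷ 83 ∷ 116 ∷ []) ∷
  (4 ∷ 16 ∷ 17 ∷ 32 ∷ 36 ∷ 40 ∷ 42 ∷ 52 ∷ 54 ∷ 68 ∷ 80 ∷ 113 ∷ []) ∷ (5 ∷ 18 ∷ 19 ∷ 33 ∷ 37 ∷ 44 ∷ 46 ∷ 53 ∷ 55 ∷ 70 ∷ 81 ∷ 117 ∷ []) ∷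
  (4 ∷ 12 ∷ 13 ∷ 34 ∷ 38 ∷ 41 ∷ 43 ∷ 48 ∷ 50 ∷ 65 ∷ 86 ∷ 114 ∷ []) ∷ (5 ∷ 14 ∷ 15 ∷ 35 ∷ 39 ∷ 45 ∷ 47 ∷ 49 ∷ 51 ∷ 67 ∷ 87 ∷ 118 ∷ []) ∷
  (4 ∷ 20 ∷ 21 ∷ 34 ∷ 38 ∷ 41 ∷ 43 ∷ 52 ∷ 54 ∷ 69 ∷ 84 ∷ 115 ∷ []) ∷ (5 ∷ 22 ∷ 23 ∷ 35 ∷ 39 ∷ 45 ∷ 47 ∷ 53 ∷ 55 ∷ 71 ∷ 85 ∷ 119 ∷ []) ∷
  (2 ∷ 8 ∷ 10 ∷ 24 ∷ 26 ∷ 40 ∷ 44 ∷ 56 ∷ 64 ∷ 66 ∷ 90 ∷ 104 ∷ []) ∷ (3 ∷ 12 ∷ 14 ∷ 28 ∷ 30 ∷ 41 ∷ 45 ∷ 58 ∷ 65 ∷ 67 ∷ 91 ∷ 108 ∷ []) ∷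
  (2 ∷ 16 ∷ 18 ∷ 24 ∷ 26 ∷ 40 ∷ 44 ∷ 60 ∷ 68 ∷ 70 ∷ 88 ∷ 105 ∷ []) ∷ (3 ∷ 20 ∷ 22 ∷ 28 ∷ 30 ∷ 41 ∷ 45 ∷ 62 ∷ 69 ∷ 71 ∷ 89 ∷ 109 ∷ []) ∷
  (2 ∷ 9 ∷ 11 ∷ 25 ∷ 27 ∷ 42 ∷ 46 ∷ 57 ∷ 64 ∷ 66 ∷ 94 ∷ 106 ∷ []) ∷ (3 ∷ 13 ∷ 15 ∷ 29 ∷ 31 ∷ 43 ∷ 47 ∷ 59 ∷ 65 ∷ 67 ∷ 95 ∷ 110 ∷ []) ∷
  (2 ∷ 17 ∷ 19 ∷ 25 ∷ 27 ∷ 42 ∷ 46 ∷ 61 ∷ 68 ∷ 70 ∷ 92 ∷ 107 ∷ []) ∷ (3 ∷ 21 ∷ 23 ∷ 29 ∷ 31 ∷ 43 ∷ 47 ∷ 63 ∷ 69 ∷ 71 ∷ 93 ∷ 111 ∷ []) ∷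
  (0 ∷ 8 ∷ 12 ∷ 48 ∷ 56 ∷ 58 ∷ 72 ∷ 98 ∷ 104 ∷ 108 ∷ 112 ∷ 114 ∷ []) ∷ (1 ∷ 16 ∷ 20 ∷ 52 ∷ 60 ∷ 62 ∷ 74 ∷ 99 ∷ 105 ∷ 109 ∷ 113 ∷ 115 ∷ []) ∷
  (0 ∷ 10 ∷ 14 ∷ 49 ∷ 56 ∷ 58 ∷ 76 ∷ 96 ∷ 104 ∷ 108 ∷ 116 ∷ 118 ∷ []) ∷ (1 ∷ 18 ∷ 22 ∷ 53 ∷ 60 ∷ 62 ∷ 78 ∷ 97 ∷ 105 ∷ 109 ∷ 117 ∷ 119 ∷ []) ∷
  (0 ∷ 9 ∷ 13 ∷ 50 ∷ 57 ∷ 59 ∷ 73 ∷ 102 ∷ 106 ∷ 110 ∷ 112 ∷ 114 ∷ []) ∷ (1 ∷ 17 ∷ 21 ∷ 54 ∷ 61 ∷ 63 ∷ 75 ∷ 103 ∷ 107 ∷ 111 ∷ 113 ∷ 115 ∷ []) ∷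
  (0 ∷ 11 ∷ 15 ∷ 51 ∷ 57 ∷ 59 ∷ 77 ∷ 100 ∷ 106 ∷ 110 ∷ 116 ∷ 118 ∷ []) ∷ (1 ∷ 19 ∷ 23 ∷ 55 ∷ 61 ∷ 63 ∷ 79 ∷ 101 ∷ 107 ∷ 111 ∷ 117 ∷ 119 ∷ []) ∷
  (0 ∷ 8 ∷ 10 ∷ 56 ∷ 64 ∷ 66 ∷ 88 ∷ 96 ∷ 98 ∷ 106 ∷ 112 ∷ 116 ∷ []) ∷ (1 ∷ 16 ∷ 18 ∷ 60 ∷ 68 ∷ 70 ∷ 90 ∷ 97 ∷ 99 ∷ 107 ∷ 113 ∷ 117 ∷ []) ∷
  (0 ∷ 9 ∷ 11 ∷ 57 ∷ 64 ∷ 66 ∷ 92 ∷ 100 ∷ 102 ∷ 104 ∷ 112 ∷ 116 ∷ []) ∷ (1 ∷ 17 ∷ 19 ∷ 61 ∷ 68 ∷ 70 ∷ 94 ∷ 101 ∷ 103 ∷ 105 ∷ 113 ∷ 117 ∷ []) ∷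
  (0 ∷ 12 ∷ 14 ∷ 58 ∷ 65 ∷ 67 ∷ 89 ∷ 96 ∷ 98 ∷ 110 ∷ 114 ∷ 118 ∷ []) ∷ (1 ∷ 20 ∷ 22 ∷ 62 ∷ 69 ∷ 71 ∷ 91 ∷ 97 ∷ 99 ∷ 111 ∷ 115 ∷ 119 ∷ []) ∷
  (0 ∷ 13 ∷ 15 ∷ 59 ∷ 65 ∷ 67 ∷ 93 ∷ 100 ∷ 102 ∷ 108 ∷ 114 ∷ 118 ∷ []) ∷ (1 ∷ 21 ∷ 23 ∷ 63 ∷ 69 ∷ 71 ∷ 95 ∷ 101 ∷ 103 ∷ 109 ∷ 115 ∷ 119 ∷ []) ∷
  (0 ∷ 8 ∷ 9 ∷ 48 ∷ 50 ∷ 64 ∷ 80 ∷ 96 ∷ 100 ∷ 104 ∷ 106 ∷ 114 ∷ []) ∷ (1 ∷ 16 ∷ 17 ∷ 52 ∷ 54 ∷ 68 ∷ 82 ∷ 97 ∷ 101 ∷ 105 ∷ 107 ∷ 115 ∷ []) ∷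
  (0 ∷ 12 ∷ 13 ∷ 48 ∷ 50 ∷ 65 ∷ 84 ∷ 96 ∷ 100 ∷ 108 ∷ 110 ∷ 112 ∷ []) ∷ (1 ∷ 20 ∷ 21 ∷ 52 ∷ 54 ∷ 69 ∷ 86 ∷ 97 ∷ 101 ∷ 109 ∷ 111 ∷ 113 ∷ []) ∷
  (0 ∷ 10 ∷ 11 ∷ 49 ∷ 51 ∷ 66 ∷ 81 ∷ 98 ∷ 102 ∷ 104 ∷ 106 ∷ 118 ∷ []) ∷ (1 ∷ 18 ∷ 19 ∷ 53 ∷ 55 ∷ 70 ∷ 83 ∷ 99 ∷ 103 ∷ 105 ∷ 107 ∷ 119 ∷ []) ∷
  (0 ∷ 14 ∷ 15 ∷ 49 ∷ 51 ∷ 67 ∷ 85 ∷ 98 ∷ 102 ∷ 108 ∷ 110 ∷ 116 ∷ []) ∷ (1 ∷ 22 ∷ 23 ∷ 53 ∷ 55 ∷ 71 ∷ 87 ∷ 99 ∷ 103 ∷ 109 ∷ 111 ∷ 117 ∷ []) ∷ []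

neighbours : Fin 120 → List (Fin 120)
neighbours p = map toFin (lookup neighbourTable p)

AdjacentIn : Vec Q 120 → V → V → Set
AdjacentIn xs p q = dot4 (lookup xs p) (lookup xs q) ≡ (+ 0 , + 2)

adjacentIn? : ∀ xs p q → Dec (AdjacentIn xs p q)
adjacentIn? xs p q = ≡-dec× _≟ℤ_ _≟ℤ_ (dot4 (lookup xs p) (lookup xs q)) (+ 0 , + 2)

_≟Q_ : (u v : Q) → Dec (u ≡ v)
_≟Q_ = ≡-decVec (≡-dec× _≟ℤ_ _≟ℤ_)

-- Checks that range over many vertices take the coordinates as an argument
-- vector, so that they are computed once rather than at every lookup.
coordinates : Vec Q 120
coordinates = Vec.fromList vertexList

lookup-coordinates : ∀ p → lookup coordinates p ≡ vert p
lookup-coordinates = lookup-fromList vertexList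

AdjacentIn-coordinates : ∀ p q → AdjacentIn coordinates p q ≡ Adjacent p q
AdjacentIn-coordinates p q =
  cong₂ (λ x y → dot4 x y ≡ (+ 0 , + 2)) (lookup-coordinates p) (lookup-coordinates q)

neighbour⇒adjacent : ∀ {p q} → q ∈ᴸ neighbours p → Adjacent p q
neighbour⇒adjacent {p} {q} q∈ = subst (λ A → A) (AdjacentIn-coordinates p q) (All.lookup (sound p) q∈)
  where
  sound? : (xs : Vec Q 120) → Dec (∀ p → All (AdjacentIn xs p) (neighbours p))
  sound? xs = all-vertices? λ p → All.all? (adjacentIn? xs p) (neighbours p)
  sound : ∀ p → All (AdjacentIn coordinates p) (neighbours p)
  sound = by-evaluation (sound? coordinates) refl

adjacent⇒neighbour : ∀ {p q} → Adjacent p q → q ∈ᴸ neighbours p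
adjacent⇒neighbour {p} {q} adj = complete p q (subst (λ A → A) (sym (AdjacentIn-coordinates p q)) adj)
  where
  complete? : (xs : Vec Q 120) → Dec (∀ p q → AdjacentIn xs p q → q ∈ᴸ neighbours p)
  complete? xs = all-vertices? λ p → all-vertices? λ q → adjacentIn? xs p q →-dec (q ∈? neighbours p)
  complete : ∀ p q → AdjacentIn coordinates p q → q ∈ᴸ neighbours p
  complete = by-evaluation (complete? coordinates) refl

data Line : Set where
  row col : Fin 5 → Line

colouring : Line → V → Fin 5
colouring (row i) p = τ p i
colouring (col j) p = φ p ⟨$⟩ˡ j

cell : Line → Fin 5 → Grid
cell (row i) c = i , c
cell (col j) c = c , j

-- Opaque, so that type checking never unfolds a colour class into its 120 entries.
opaque
  ι : Grid → Subset (length vertexList)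
  ι (i , j) = colorClass (colouring (row i)) j

  ι-unfold : ∀ i j → ι (i , j) ≡ colorClass (colouring (row i)) j
  ι-unfold i j = refl

∈-ι : ∀ {p i j} → p ∈ ι (i , j) ⇔ τ p i ≡ j
∈-ι {p} {i} {j} =
  subst (λ S → p ∈ S ⇔ τ p i ≡ j) (sym (ι-unfold i j)) (∈-colorClass {colouring (row i)} {j} {p})

colorClass-line : ∀ ℓ c → colorClass (colouring ℓ) c ≡ ι (cell ℓ c)
colorClass-line (row i) c = sym (ι-unfold i c)
colorClass-line (col j) i = trans (colorClass-cong {colouring (col j)} {colouring (row i)} {i} {j} λ p →
  ⟨$⟩ˡ≡⇔⟨$⟩ʳ≡ (φ p) {i} {j})
  (sym (ι-unfold i j))

neighbours-differ-everywhere : ∀ p → All (λ q → ∀ i → τ p i ≢ τ q i) (neighbours p)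
neighbours-differ-everywhere = by-evaluation
  (all-vertices? λ p → All.all? (λ q → all? λ i → ¬? (τ p i ≟ τ q i)) (neighbours p)) refl

colouring-proper : ∀ ℓ → IsFiveColoring (colouring ℓ)
colouring-proper (row i) p q adj = All.lookup (neighbours-differ-everywhere p) (adjacent⇒neighbour {p} {q} adj) i
colouring-proper (col j) p q adj eq = colouring-proper (row i) p q adj (begin
  τ p i                    ≡⟨ inverseʳ (φ p) ⟩
  j                        ≡⟨ inverseʳ (φ q) ⟨
  τ q (φ q ⟨$⟩ˡ j)         ≡⟨ cong (τ q) eq ⟨
  τ q i                    ∎)
  where
  open ≡-Reasoning
  i : Fin 5
  i = φ p ⟨$⟩ˡ j

classes-of-renamed-line : ∀ {f ℓ} → Renaming f (colouring ℓ) →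
  (∀ c → ∃[ d ] colorClass f c ≡ ι (cell ℓ d)) × (∀ d → ∃[ c ] ι (cell ℓ d) ≡ colorClass f c)
classes-of-renamed-line {f} {ℓ} r@(σ , _) =
  (λ c → σ ⟨$⟩ˡ c , trans (colorClass-renaming r c) (colorClass-line ℓ (σ ⟨$⟩ˡ c))) ,
  (λ d → σ ⟨$⟩ʳ d , (begin
    ι (cell ℓ d)                                 ≡⟨ colorClass-line ℓ d ⟨
    colorClass (colouring ℓ) d                   ≡⟨ cong (colorClass (colouring ℓ)) (inverseˡ σ) ⟨
    colorClass (colouring ℓ) (σ ⟨$⟩ˡ (σ ⟨$⟩ʳ d)) ≡⟨ colorClass-renaming r (σ ⟨$⟩ʳ d) ⟨
    colorClass f (σ ⟨$⟩ʳ d)                      ∎))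
  where open ≡-Reasoning

simplex-of-renamed-line : ∀ {f} ℓ → Renaming f (colouring ℓ) →
  (∃[ i ] ClassesAreRow ι f i) ⊎ (∃[ j ] ClassesAreCol ι f j)
simplex-of-renamed-line {f} (row i) r = inj₁ (i , classes-of-renamed-line {f} {row i} r)
simplex-of-renamed-line {f} (col j) r = inj₂ (j , classes-of-renamed-line {f} {col j} r)

-- Classification of the five-colourings

open ColouringSearch {n = 120} {k = 5} neighbours

tetrahedron : List (Fin 120)
tetrahedron = map toFin (0 ∷ 96 ∷ 98 ∷ 104 ∷ [])

-- The remaining vertices, in an order that keeps the search tree small
-- (about 1600 nodes).
searchOrder : List (Fin 120)
searchOrder = map toFin (
  56 ∷ 8 ∷ 112 ∷ 10 ∷ 88 ∷ 64 ∷ 66 ∷ 106 ∷ 116 ∷ 2 ∷ 40 ∷ 24 ∷ 26 ∷ 44 ∷ 90 ∷ 72 ∷ 6 ∷ 58 ∷ 76 ∷ 32 ∷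
  48 ∷ 80 ∷ 9 ∷ 42 ∷ 92 ∷ 11 ∷ 46 ∷ 81 ∷ 33 ∷ 49 ∷ 12 ∷ 108 ∷ 114 ∷ 14 ∷ 118 ∷ 50 ∷ 100 ∷ 102 ∷ 51 ∷ 57 ∷
  110 ∷ 4 ∷ 34 ∷ 84 ∷ 13 ∷ 65 ∷ 28 ∷ 74 ∷ 89 ∷ 30 ∷ 41 ∷ 67 ∷ 15 ∷ 59 ∷ 73 ∷ 36 ∷ 25 ∷ 38 ∷ 77 ∷ 27 ∷
  7 ∷ 37 ∷ 82 ∷ 16 ∷ 52 ∷ 60 ∷ 68 ∷ 94 ∷ 17 ∷ 54 ∷ 75 ∷ 86 ∷ 20 ∷ 29 ∷ 43 ∷ 93 ∷ 3 ∷ 21 ∷ 31 ∷ 61 ∷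
  62 ∷ 78 ∷ 91 ∷ 69 ∷ 95 ∷ 63 ∷ 79 ∷ 18 ∷ 70 ∷ 19 ∷ 83 ∷ 5 ∷ 35 ∷ 85 ∷ 39 ∷ 45 ∷ 47 ∷ 22 ∷ 53 ∷ 87 ∷
  55 ∷ 23 ∷ 71 ∷ 97 ∷ 99 ∷ 105 ∷ 109 ∷ 113 ∷ 115 ∷ 101 ∷ 107 ∷ 111 ∷ 1 ∷ 103 ∷ 117 ∷ 119 ∷ [])

-- The colourings found by the search, in the order it finds them: each is a
-- line colouring with its colours renamed by the given vector.
certificates : List (Line × Vec (Fin 5) 5)
certificates =
  (col (# 3) , # 3 ∷ # 2 ∷ # 1 ∷ # 4 ∷ # 0 ∷ []) ∷
  (row (# 3) , # 2 ∷ # 3 ∷ # 1 ∷ # 4 ∷ # 0 ∷ []) ∷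
  (row (# 2) , # 3 ∷ # 4 ∷ # 0 ∷ # 1 ∷ # 2 ∷ []) ∷
  (col (# 2) , # 2 ∷ # 4 ∷ # 0 ∷ # 1 ∷ # 3 ∷ []) ∷
  (row (# 4) , # 4 ∷ # 2 ∷ # 3 ∷ # 0 ∷ # 1 ∷ []) ∷
  (col (# 4) , # 4 ∷ # 3 ∷ # 2 ∷ # 0 ∷ # 1 ∷ []) ∷
  (col (# 1) , # 1 ∷ # 0 ∷ # 4 ∷ # 3 ∷ # 2 ∷ []) ∷
  (row (# 1) , # 1 ∷ # 0 ∷ # 4 ∷ # 2 ∷ # 3 ∷ []) ∷
  (row (# 0) , # 0 ∷ # 1 ∷ # 2 ∷ # 3 ∷ # 4 ∷ []) ∷
  (col (# 0) , # 0 ∷ # 1 ∷ # 3 ∷ # 2 ∷ # 4 ∷ []) ∷ []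

corner : Fin 4 → V
corner = List.lookup tetrahedron

reference : V → Fin 5
reference = colouring (row zero)

precolour : Fin 120 → Maybe (Fin 5)
precolour u = if does (u ∈? tetrahedron) then just (reference u) else nothing

precolouring : PartialColouring
precolouring = tabulate precolour

recolouredLine : Line × Vec (Fin 5) 5 → V → Maybe (Fin 5)
recolouredLine (ℓ , h) p = just (lookup h (colouring ℓ p))

search-result : extensions searchOrder precolouring ≡ map (tabulate ∘ recolouredLine) certificates
search-result = refl

tetrahedron-injective : ∀ {f} → IsFiveColoring f → Injective _≡_ _≡_ (f ∘ corner)
tetrahedron-injective {f} f-proper {a} {b} eq with a ≟ b
... | yes a≡b = a≡b
... | no a≢b  =
  ⊥-elim (f-proper (corner a) (corner b) (neighbour⇒adjacent {corner a} {corner b} (clique a b a≢b)) eq)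
  where
  clique : ∀ a b → a ≢ b → corner b ∈ᴸ neighbours (corner a)
  clique = by-evaluation
    (all? λ a → all? λ b → ¬? (a ≟ b) →-dec (corner b ∈? neighbours (corner a))) refl

normalisation : ∀ {f} → IsFiveColoring f → ∃[ π ] precolouring ⊑ (λ p → π ⟨$⟩ʳ f p)
normalisation {f} f-proper =
  π , λ {u} eq → on-tetrahedron u (u ∈? tetrahedron) (trans (sym (lookup∘tabulate precolour u)) eq)
  where
  π-sends : ∃[ π ] ∀ k → π ⟨$⟩ʳ f (corner k) ≡ reference (corner k)
  π-sends = injective⇒∃permutation (tetrahedron-injective {f} f-proper)
                                    (tetrahedron-injective {reference} (colouring-proper (row zero)))
  π : Permutation′ 5
  π = proj₁ π-sends
  on-tetrahedron : ∀ u {c} (u∈? : Dec (u ∈ᴸ tetrahedron)) →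
    (if does u∈? then just (reference u) else nothing) ≡ just c → π ⟨$⟩ʳ f u ≡ c
  on-tetrahedron u (yes u∈) eq = trans
    (subst (λ t → π ⟨$⟩ʳ f t ≡ reference t) (sym (lookup-index u∈)) (proj₂ π-sends (Any.index u∈)))
    (just-injective eq)
  on-tetrahedron u (no _) ()

precolouring-covers : ∀ {g} → precolouring ⊑ g →
                      ∀ u → u ∈ᴸ searchOrder ⊎ lookup precolouring u ≡ just (g u)
precolouring-covers {g} pre⊑πf u = Sum.map₂ coloured (covered u)
  where
  covered : ∀ u → u ∈ᴸ searchOrder ⊎ u ∈ᴸ tetrahedron
  covered = by-evaluation (all-vertices? λ u → (u ∈? searchOrder) ⊎-dec (u ∈? tetrahedron)) refl
  coloured : u ∈ᴸ tetrahedron → lookup precolouring u ≡ just (g u)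
  coloured u∈ = trans precoloured (cong just (sym (pre⊑πf precoloured)))
    where
    precoloured : lookup precolouring u ≡ just (reference u)
    precoloured = trans (lookup∘tabulate precolour u)
      (cong (λ b → if b then just (reference u) else nothing) (dec-true (u ∈? tetrahedron) u∈))

certificates-injective : All (λ c → Injective _≡_ _≡_ (lookup (proj₂ c))) certificates
certificates-injective = by-evaluation (All.all? (λ c → injective? (lookup (proj₂ c))) certificates) refl

renaming-of-certificate : ∀ {g} →
  (∃[ c ] c ∈ᴸ certificates × tabulate (just ∘ g) ≡ tabulate (recolouredLine c)) →
  ∃[ ℓ ] Renaming g (colouring ℓ)
renaming-of-certificate {g} ((ℓ , h) , c∈ , g≡c) = ℓ , η , λ p → begin
  g p                       ≡⟨ just-injective (begin
    just (g p)                                   ≡⟨ lookup∘tabulate (just ∘ g) p ⟨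
    lookup (tabulate (just ∘ g)) p               ≡⟨ cong (λ v → lookup v p) g≡c ⟩
    lookup (tabulate (recolouredLine (ℓ , h))) p ≡⟨ lookup∘tabulate (recolouredLine (ℓ , h)) p ⟩
    just (lookup h (colouring ℓ p))              ∎) ⟩
  lookup h (colouring ℓ p)  ≡⟨ proj₂ η-spec (colouring ℓ p) ⟨
  η ⟨$⟩ʳ colouring ℓ p      ∎
  where
  open ≡-Reasoning
  η-spec : ∃[ η ] ∀ k → η ⟨$⟩ʳ k ≡ lookup h k
  η-spec = injective⇒permutation (All.lookup certificates-injective c∈)
  η : Permutation′ 5
  η = proj₁ η-spec

normalised⇒renamed-line : ∀ {f} → IsFiveColoring f → ∀ π → precolouring ⊑ (λ p → π ⟨$⟩ʳ f p) →
                          ∃[ ℓ ] Renaming f (colouring ℓ)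
normalised⇒renamed-line {f} f-proper π pre⊑πf =
  map₂ (renaming-∘ π) (renaming-of-certificate (∈-map⁻ (tabulate ∘ recolouredLine) g-found))
  where
  g-proper : ∀ {v u} → u ∈ᴸ neighbours v → π ⟨$⟩ʳ f v ≢ π ⟨$⟩ʳ f u
  g-proper {v} {u} u∈ eq = f-proper v u (neighbour⇒adjacent {v} {u} u∈) (permutation-injective π eq)
  g-found : tabulate (λ p → just (π ⟨$⟩ʳ f p)) ∈ᴸ map (tabulate ∘ recolouredLine) certificates
  g-found = subst (tabulate (λ p → just (π ⟨$⟩ʳ f p)) ∈ᴸ_) search-result
    (∈-extensions {g = λ p → π ⟨$⟩ʳ f p} g-proper searchOrder precolouring pre⊑πf
                  (precolouring-covers pre⊑πf))

classification : ∀ f → IsFiveColoring f → ∃[ ℓ ] Renaming f (colouring ℓ)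
classification f f-proper = uncurry (normalised⇒renamed-line f-proper) (normalisation f-proper)

-- The grid complex

cells-separated : ∀ i j i′ j′ → (i , j) ≢ (i′ , j′) → ∃[ p ] τ p i ≡ j × τ p i′ ≢ j′
cells-separated = by-evaluation (all? λ i → all? λ j → all? λ i′ → all? λ j′ →
  ¬? (≡-dec× _≟_ _≟_ (i , j) (i′ , j′)) →-dec any-vertex? λ p → (τ p i ≟ j) ×-dec ¬? (τ p i′ ≟ j′)) refl

ι-injective : ∀ x y → ι x ≡ ι y → x ≡ y
ι-injective (i , j) (i′ , j′) eq =
  decidable-stable (≡-dec× _≟_ _≟_ (i , j) (i′ , j′)) (refute ∘ cells-separated i j i′ j′)
  where
  refute : ∃[ p ] τ p i ≡ j × τ p i′ ≢ j′ → ⊥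
  refute (p , τpi≡j , τpi′≢j′) = τpi′≢j′ (Equivalence.to (∈-ι {p} {i′} {j′})
    (subst (p ∈_) eq (Equivalence.from (∈-ι {p} {i} {j}) τpi≡j)))

ι-onto : ∀ S → IsVertexB S → ∃[ x ] ι x ≡ S
ι-onto S (f , f-proper , c , S≡) = uncurry onto (classification f f-proper)
  where
  onto : ∀ ℓ → Renaming f (colouring ℓ) → ∃[ x ] ι x ≡ S
  onto ℓ r@(σ , _) = cell ℓ (σ ⟨$⟩ˡ c) , (begin
    ι (cell ℓ (σ ⟨$⟩ˡ c))               ≡⟨ colorClass-line ℓ (σ ⟨$⟩ˡ c) ⟨
    colorClass (colouring ℓ) (σ ⟨$⟩ˡ c) ≡⟨ colorClass-renaming {f} {colouring ℓ} r c ⟨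
    colorClass f c                      ≡⟨ S≡ ⟨
    S                                   ∎)
    where open ≡-Reasoning

gridIso : GridIso ι
gridIso = record
  { lands     = λ (i , j) → colouring (row i) , colouring-proper (row i) , j , ι-unfold i j
  ; onto      = ι-onto
  ; injective = ι-injective
  ; simplices = λ f f-proper → uncurry (simplex-of-renamed-line {f}) (classification f f-proper)
  ; rowsHit   = λ i → colouring (row i) , colouring-proper (row i) ,
                      classes-of-renamed-line {colouring (row i)} {row i} (idₚ , λ _ → refl)
  ; colsHit   = λ j → colouring (col j) , colouring-proper (col j) ,
                      classes-of-renamed-line {colouring (col j)} {col j} (idₚ , λ _ → refl)
  }

-- The map φ

phiIs : ∀ {p σ} → (∀ i → τ p i ≡ σ ⟨$⟩ʳ i) → PhiIs ι p σ
phiIs {p} agree i j = mk⇔ (λ m → trans (sym (agree i)) (Equivalence.to (∈-ι {p} {i} {j}) m))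
                          (λ e → Equivalence.from (∈-ι {p} {i} {j}) (trans (agree i) e))

inversionsOf : (Fin 5 → Fin 5) → ℕ
inversionsOf f = length (filter (λ ij → proj₁ ij <? proj₂ ij)
                   (filter (λ ij → f (proj₂ ij) <? f (proj₁ ij)) (cartesianProduct (allFin 5) (allFin 5))))

inversionsOf-cong : ∀ {f g} → (∀ i → f i ≡ g i) → inversionsOf f ≡ inversionsOf g
inversionsOf-cong {f} {g} f≗g = cong (length ∘ filter (λ ij → proj₁ ij <? proj₂ ij))
  (filter-≐ (λ ij → f (proj₂ ij) <? f (proj₁ ij)) (λ ij → g (proj₂ ij) <? g (proj₁ ij))
    ((λ {ij} → subst₂ Fin._<_ (f≗g (proj₂ ij)) (f≗g (proj₁ ij))) ,
     (λ {ij} → subst₂ Fin._<_ (sym (f≗g (proj₂ ij))) (sym (f≗g (proj₁ ij)))))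
    (cartesianProduct (allFin 5) (allFin 5)))

φ-even : ∀ p → IsEvenPerm (φ p)
φ-even = by-evaluation (all-vertices? λ p → 2 ∣? inversions (φ p)) refl

τ-attains-even : ∀ v → Injective _≡_ _≡_ (lookup v) → 2 ∣ inversionsOf (lookup v) →
                     ∃[ p ] ∀ i → τ p i ≡ lookup v i
τ-attains-even = by-evaluation
  (all-vectors? λ v → injective? (lookup v) →-dec (2 ∣? inversionsOf (lookup v) →-dec
                      any-vertex? λ p → all? λ i → τ p i ≟ lookup v i)) refl

φ-onto-even : ∀ σ → IsEvenPerm σ → ∃[ p ] PhiIs ι p σ
φ-onto-even σ σ-even = reach (τ-attains-even v v-injective v-even)
  where
  v : Vec (Fin 5) 5
  v = tabulate (σ ⟨$⟩ʳ_)
  v≗σ : ∀ i → lookup v i ≡ σ ⟨$⟩ʳ i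
  v≗σ = lookup∘tabulate (σ ⟨$⟩ʳ_)
  v-injective : Injective _≡_ _≡_ (lookup v)
  v-injective eq = permutation-injective σ (trans (sym (v≗σ _)) (trans eq (v≗σ _)))
  v-even : 2 ∣ inversionsOf (lookup v)
  v-even = subst (2 ∣_) (inversionsOf-cong (λ i → sym (v≗σ i))) σ-even
  reach : ∃[ p ] (∀ i → τ p i ≡ lookup v i) → ∃[ p ] PhiIs ι p σ
  reach (p , τp≡v) = p , phiIs {p} {σ} (λ i → trans (τp≡v i) (v≗σ i))

antipodes-agree : ∀ p q → vert q ≡ negQ (vert p) → ∀ i → τ p i ≡ τ q i
antipodes-agree p q antipodal = agree p q
  (subst₂ (λ x y → x ≡ negQ y) (sym (lookup-coordinates q)) (sym (lookup-coordinates p)) antipodal)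
  where
  agree? : (xs : Vec Q 120) →
           Dec (∀ p q → lookup xs q ≡ negQ (lookup xs p) → ∀ i → τ p i ≡ τ q i)
  agree? xs = all-vertices? λ p → all-vertices? λ q →
    (lookup xs q ≟Q negQ (lookup xs p)) →-dec all? λ i → τ p i ≟ τ q i
  agree : ∀ p q → lookup coordinates q ≡ negQ (lookup coordinates p) → ∀ i → τ p i ≡ τ q i
  agree = by-evaluation (agree? coordinates) refl

antipodes-inseparable : ∀ p q → vert q ≡ negQ (vert p) → ∀ S → IsVertexB S → (p ∈ S) ⇔ (q ∈ S)
antipodes-inseparable p q antipodal S S-vertex = uncurry inseparable (ι-onto S S-vertex)
  where
  inseparable : ∀ x → ι x ≡ S → (p ∈ S) ⇔ (q ∈ S)
  inseparable (i , j) ιx≡S = subst (λ S → (p ∈ S) ⇔ (q ∈ S)) ιx≡S (mk⇔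
    (Equivalence.from (∈-ι {q} {i} {j}) ∘ trans (sym τp≡τq) ∘ Equivalence.to (∈-ι {p} {i} {j}))
    (Equivalence.from (∈-ι {p} {i} {j}) ∘ trans τp≡τq ∘ Equivalence.to (∈-ι {q} {i} {j})))
    where
    τp≡τq : τ p i ≡ τ q i
    τp≡τq = antipodes-agree p q antipodal i

mainTheorem8 : ∃[ ι ] GridIso ι
                 × (∀ p → ∃[ σ ] IsEvenPerm σ × PhiIs ι p σ)
                 × (∀ σ → IsEvenPerm σ → ∃[ p ] PhiIs ι p σ)
                 × (∀ p q → vert q ≡ negQ (vert p) →
                      ∀ (S : Subset (length vertexList)) → IsVertexB S → (p ∈ S) ⇔ (q ∈ S))
mainTheorem8 =
  ι , gridIso ,
  (λ p → φ p , φ-even p , phiIs {p} {φ p} (λ _ → refl)) ,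
  φ-onto-even ,
  antipodes-inseparable
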